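{- If $S$ is an S-tree, then $EG(S)=\operatorname{Supp}(S)$.
   Context: For a graph $G$, $EG(G)$ is the set of vertices $v$ of $G$ such that some maximum matching of $G$ does not saturate $v$. For a tree $S$, $\mathcal{N}(S)$ is the null space of its adjacency matrix and $\operatorname{Supp}(S)=\{v\in V(S): x_v\neq0\text{ for some }x\in\mathcal{N}(S)\}$. $S$ is an S-tree if $N[\operatorname{Supp}(S)]=V(S)$, where $N[X]=\bigcup_{u\in X}(N(u)\cup\{u\})$. -}

module Defs where

open import Data.Nat using (ℕ; zero; suc; _≤_; _≥_)
open import Data.Fin using (Fin; zero; suc)
open import Data.Bool using (Bool; true; false; if_then_else_)
open import Data.List using (List; []; _∷_; length; concatMap; head; last)
open import Data.List.Relation.Unary.Unique.Propositional using (Unique)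
open import Data.List.Relation.Unary.All using (All)
open import Data.List.Relation.Unary.Any using (Any)
open import Data.List.Membership.Propositional using (_∈_)
open import Data.Product using (Σ; ∃; ∃-syntax; _×_; _,_)
open import Data.Sum using (_⊎_)
open import Data.Maybe using (just)
open import Data.Unit using (⊤)
open import Data.Rational using (ℚ; 0ℚ; 1ℚ; _+_; _*_)
open import Relation.Binary.PropositionalEquality using (_≡_; _≢_)
open import Relation.Nullary using (¬_)

record Graph (n : ℕ) : Set where
  field
    adj    : Fin n → Fin n → Bool
    sym    : ∀ u v → adj u v ≡ adj v u
    irrefl : ∀ u → adj u u ≡ false
open Graph public

Adj : ∀ {n} → Graph n → Fin n → Fin n → Set
Adj G u v = adj G u v ≡ true

data Walk {n} (G : Graph n) : Fin n → Fin n → Set where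
  here : ∀ {u} → Walk G u u
  step : ∀ {u v w} → Adj G u v → Walk G v w → Walk G u w

Connected : ∀ {n} → Graph n → Set
Connected G = ∀ u v → Walk G u v

Chain : ∀ {n} → Graph n → List (Fin n) → Set
Chain G []           = ⊤
Chain G (x ∷ [])     = ⊤
Chain G (x ∷ y ∷ xs) = Adj G x y × Chain G (y ∷ xs)

IsCycle : ∀ {n} → Graph n → List (Fin n) → Set
IsCycle G vs =
  (length vs ≥ 3) × Unique vs × Chain G vs ×
  (∃[ a ] ∃[ b ] (head vs ≡ just a × last vs ≡ just b × Adj G b a))

Acyclic : ∀ {n} → Graph n → Set
Acyclic G = ∀ vs → ¬ IsCycle G vs

IsTree : ∀ {n} → Graph n → Set
IsTree {n} G = (1 ≤ n) × Connected G × Acyclic G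

endpoints : ∀ {n} → List (Fin n × Fin n) → List (Fin n)
endpoints = concatMap (λ { (u , v) → u ∷ v ∷ [] })

IsMatching : ∀ {n} → Graph n → List (Fin n × Fin n) → Set
IsMatching G M = All (λ { (u , v) → Adj G u v }) M × Unique (endpoints M)

IsMaximumMatching : ∀ {n} → Graph n → List (Fin n × Fin n) → Set
IsMaximumMatching G M =
  IsMatching G M × (∀ M′ → IsMatching G M′ → length M′ ≤ length M)

Saturates : ∀ {n} → List (Fin n × Fin n) → Fin n → Set
Saturates M v = v ∈ endpoints M

EG : ∀ {n} → Graph n → Fin n → Set
EG G v = ∃[ M ] (IsMaximumMatching G M × ¬ Saturates M v)

Σℚ : ∀ n → (Fin n → ℚ) → ℚ
Σℚ zero    f = 0ℚ
Σℚ (suc n) f = f zero + Σℚ n (λ i → f (suc i))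

adjMatrix : ∀ {n} → Graph n → Fin n → Fin n → ℚ
adjMatrix G i j = if adj G i j then 1ℚ else 0ℚ

InNullSpace : ∀ {n} → Graph n → (Fin n → ℚ) → Set
InNullSpace {n} G x = ∀ i → Σℚ n (λ j → adjMatrix G i j * x j) ≡ 0ℚ

Supp : ∀ {n} → Graph n → Fin n → Set
Supp G v = ∃[ x ] (InNullSpace G x × x v ≢ 0ℚ)

-- S-tree: a tree with N[Supp(S)] = V(S)
IsSTree : ∀ {n} → Graph n → Set
IsSTree G = IsTree G × (∀ v → ∃[ u ] (Supp G u × (u ≡ v ⊎ Adj G u v)))

-- The S-tree hypothesis enters only through acyclicity: we prove that in every
-- forest G a vertex is left unsaturated by some maximum matching exactly when
-- some null vector of the adjacency matrix is nonzero at it.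
--
-- The proof is an induction over induced subgraphs G[W], W a decidable vertex
-- set.  Matchings and null vectors are relativised to W (null vectors vanish
-- off W and are annihilated by the rows indexed by W).  The invariant Agree W
-- says that G[W] has a maximum matching and that EG = Supp on W.  It passes
-- from a smaller set to W by one of two reductions:
--   * an isolated vertex w lies in both EG and Supp, and deleting it changes
--     nothing else (IsolatedMatching, IsolatedNull);
--   * for a leaf ℓ with neighbour p, delete both: p lies in neither set, other
--     vertices keep their status, and ℓ lies in EG resp. Supp iff some
--     neighbour of p does in G[W - ℓ - p] (PendantMatching, PendantNull).  On
--     the null-space side this needs p to have a second leaf or at most one
--     neighbour besides ℓ ("reducible" pendant edges).
-- Acyclicity makes the reductions always applicable (FindReducible): in a set
-- where every vertex has two neighbours a non-backtracking walk never stops,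
-- and by pigeonhole it closes a cycle.  The theorem is the case W = V.
module Submission where

open import Defs hiding (sym)
open import Data.Nat using (ℕ; zero; suc; _≤_; _<_; _∸_; z≤n; s≤s) renaming (_+_ to _+ℕ_)
import Data.Nat.Properties as NP
open import Data.Fin using (Fin; zero; suc; toℕ; fromℕ<)
import Data.Fin as F
open import Data.Fin.Properties using (any?; all?; pigeonhole; toℕ<n; toℕ-fromℕ<; suc-injective)
open import Data.Bool using (Bool; true; false; if_then_else_)
import Data.Bool.Properties as BP
open import Data.List using (List; []; _∷_; length; last)
open import Data.List.Relation.Unary.All using (All; []; _∷_)
open import Data.List.Relation.Unary.All.Properties using (¬Any⇒All¬; All¬⇒¬Any)
open import Data.List.Relation.Unary.Any using (here; there)
open import Data.List.Relation.Unary.AllPairs using (AllPairs; []; _∷_)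
import Data.List.Membership.DecPropositional as DecMembership
open import Data.Product using (Σ; ∃; _×_; _,_; proj₁; proj₂)
open import Data.Sum using (_⊎_; inj₁; inj₂; [_,_]′)
open import Data.Maybe using (just)
open import Data.Unit using (tt)
open import Data.Empty using (⊥; ⊥-elim)
open import Data.Rational using (ℚ; 0ℚ; 1ℚ; _+_; _*_; -_)
import Data.Rational.Properties as QP
open import Algebra.Bundles using (CommutativeMonoid)
open import Algebra.Properties.CommutativeSemigroup
  (CommutativeMonoid.commutativeSemigroup QP.+-0-commutativeMonoid) using (interchange)
open import Relation.Binary.PropositionalEquality using (_≡_; _≢_; refl; sym; trans; cong; cong₂; subst; module ≡-Reasoning)
open import Relation.Nullary using (¬_; Dec; yes; no; does)
open import Relation.Nullary.Decidable using (_×-dec_; _→-dec_; ¬?; decidable-stable)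
open import Function using (_∘_; _⇔_; mk⇔; Equivalence)
open import Data.Nat.Induction using (<-rec; <-wellFounded)
open import Induction.WellFounded using (module All)
import Relation.Binary.Construct.On as On
open import Level using (0ℓ)

VSet : ℕ → Set
VSet m = Fin m → Bool

false≢true : false ≢ true
false≢true ()

true-or-false : ∀ b → b ≡ true ⊎ b ≡ false
true-or-false true = inj₁ refl
true-or-false false = inj₂ refl

same-or-different : ∀ {m} (a b : Fin m) → a ≡ b ⊎ a ≢ b
same-or-different a b with a F.≟ b
... | yes a≡b = inj₁ a≡b
... | no a≢b = inj₂ a≢b

remove : ∀ {m} → Fin m → VSet m → VSet m
remove w W u = if does (u F.≟ w) then false else W u

remove-self : ∀ {m} (w : Fin m) W → remove w W w ≡ false
remove-self w W with w F.≟ w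
... | yes _ = refl
... | no w≢w = ⊥-elim (w≢w refl)

remove-other : ∀ {m} {w u : Fin m} W → u ≢ w → remove w W u ≡ W u
remove-other {w = w} {u} W u≢w with u F.≟ w
... | yes u≡w = ⊥-elim (u≢w u≡w)
... | no _ = refl

remove-true : ∀ {m} {w u : Fin m} W → remove w W u ≡ true → W u ≡ true × u ≢ w
remove-true {w = w} {u} W e with u F.≟ w
... | yes _ = ⊥-elim (false≢true e)
... | no u≢w = e , u≢w

remove-false : ∀ {m} {w u : Fin m} W → remove w W u ≡ false → W u ≡ false ⊎ u ≡ w
remove-false {w = w} {u} W e with u F.≟ w
... | yes u≡w = inj₂ u≡w
... | no _ = inj₁ e

-- The number of elements of a vertex set: the measure of the main induction.
count : ∀ {m} → VSet m → ℕ
count {zero} W = 0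
count {suc m} W = (if W zero then 1 else 0) +ℕ count (W ∘ suc)

count-cong : ∀ {m} (V W : VSet m) → (∀ u → V u ≡ W u) → count V ≡ count W
count-cong {zero} V W e = refl
count-cong {suc m} V W e =
  cong₂ _+ℕ_ (cong (λ b → if b then 1 else 0) (e zero)) (count-cong (V ∘ suc) (W ∘ suc) (e ∘ suc))

remove-suc : ∀ {m} (w : Fin m) (W : VSet (suc m)) u → remove (suc w) W (suc u) ≡ remove w (W ∘ suc) u
remove-suc w W u with u F.≟ w
... | yes refl = refl
... | no _ = refl

count-remove : ∀ {m} (w : Fin m) (W : VSet m) → W w ≡ true → suc (count (remove w W)) ≡ count W
count-remove {suc m} zero W e rewrite e =
  cong suc (count-cong (remove zero W ∘ suc) (W ∘ suc) (λ u → remove-other {w = zero} {u = suc u} W (λ ())))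
count-remove {suc m} (suc w) W e
  rewrite remove-other {w = suc w} {u = zero} W (λ ())
        | count-cong (remove (suc w) W ∘ suc) (remove w (W ∘ suc)) (remove-suc w W)
        = trans (sym (NP.+-suc (if W zero then 1 else 0) _))
                (cong ((if W zero then 1 else 0) +ℕ_) (count-remove w (W ∘ suc) e))

count-remove-< : ∀ {m} (w : Fin m) (W : VSet m) → W w ≡ true → count (remove w W) < count W
count-remove-< w W e = NP.≤-reflexive (count-remove w W e)

Σ-cong : ∀ m (f g : Fin m → ℚ) → (∀ j → f j ≡ g j) → Σℚ m f ≡ Σℚ m g
Σ-cong zero f g e = refl
Σ-cong (suc m) f g e = cong₂ _+_ (e zero) (Σ-cong m (f ∘ suc) (g ∘ suc) (e ∘ suc))

Σ-zero : ∀ m (f : Fin m → ℚ) → (∀ j → f j ≡ 0ℚ) → Σℚ m f ≡ 0ℚ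
Σ-zero zero f e = refl
Σ-zero (suc m) f e rewrite e zero | Σ-zero m (f ∘ suc) (e ∘ suc) = refl

Σ-nonzero-term : ∀ m (f : Fin m → ℚ) → Σℚ m f ≢ 0ℚ → ∃ λ j → f j ≢ 0ℚ
Σ-nonzero-term zero f Σ≢0 = ⊥-elim (Σ≢0 refl)
Σ-nonzero-term (suc m) f Σ≢0 with f zero QP.≟ 0ℚ
... | no f0≢0 = zero , f0≢0
... | yes f0≡0 with Σ-nonzero-term m (f ∘ suc) (λ e → Σ≢0 (cong₂ _+_ f0≡0 e))
...   | j , fj≢0 = suc j , fj≢0

Σ-single : ∀ m (f : Fin m → ℚ) (k : Fin m) → (∀ j → j ≢ k → f j ≡ 0ℚ) → Σℚ m f ≡ f k
Σ-single (suc m) f zero e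
  rewrite Σ-zero m (f ∘ suc) (λ j → e (suc j) (λ ())) = QP.+-identityʳ (f zero)
Σ-single (suc m) f (suc k) e rewrite e zero (λ ()) =
  trans (QP.+-identityˡ _) (Σ-single m (f ∘ suc) k (λ j j≢k → e (suc j) (j≢k ∘ suc-injective)))

Σ-+ : ∀ m (f g : Fin m → ℚ) → Σℚ m (λ j → f j + g j) ≡ Σℚ m f + Σℚ m g
Σ-+ zero f g = refl
Σ-+ (suc m) f g rewrite Σ-+ m (f ∘ suc) (g ∘ suc) = interchange (f zero) (g zero) _ _

module _ {m : ℕ} (f : ℕ → Fin m) where

  Recurs : ℕ → Set
  Recurs j = ∃ λ (i : Fin j) → f (toℕ i) ≡ f j

  recurs? : ∀ j → Dec (Recurs j)
  recurs? j = any? λ i → f (toℕ i) F.≟ f j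

  someRecurrence : ∃ Recurs
  someRecurrence with pigeonhole (NP.n<1+n m) (λ i → f (toℕ i))
  ... | i , j , i<j , fi≡fj = toℕ j , fromℕ< i<j , trans (cong f (toℕ-fromℕ< i<j)) fi≡fj

  LeastRecurrence : Set
  LeastRecurrence = ∃ λ j → Recurs j × (∀ k → k < j → ¬ Recurs k)

  leastRecurrence : ∀ j → Recurs j → LeastRecurrence
  leastRecurrence = <-rec (λ j → Recurs j → LeastRecurrence) search
    where
    search : ∀ j → (∀ {k} → k < j → Recurs k → LeastRecurrence) → Recurs j → LeastRecurrence
    search j earlier rj with any? (λ (k : Fin j) → recurs? (toℕ k))
    ... | yes (k , rk) = earlier (toℕ<n k) rk
    ... | no none = j , rj , λ k k<j rk → none (fromℕ< k<j , subst Recurs (sym (toℕ-fromℕ< k<j)) rk)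

record FirstRepeat {m : ℕ} (f : ℕ → Fin m) : Set where
  field
    i j : ℕ
    i<j : i < j
    repeat : f i ≡ f j
    injective-below : ∀ b c → b < c → c < j → f b ≢ f c

firstRepeat : ∀ {m} (f : ℕ → Fin m) → FirstRepeat f
firstRepeat f with leastRecurrence f (proj₁ (someRecurrence f)) (proj₂ (someRecurrence f))
... | j , (i , fi≡fj) , first = record
  { i = toℕ i ; j = j ; i<j = toℕ<n i ; repeat = fi≡fj
  ; injective-below = λ b c b<c c<j fb≡fc → first c c<j (fromℕ< b<c , trans (cong f (toℕ-fromℕ< b<c)) fb≡fc) }

segment : {A : Set} → (ℕ → A) → ℕ → ℕ → List A
segment f a zero = []
segment f a (suc k) = f a ∷ segment f (suc a) k

module _ {A : Set} (f : ℕ → A) where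

  segment-length : ∀ a k → length (segment f a k) ≡ k
  segment-length a zero = refl
  segment-length a (suc k) = cong suc (segment-length (suc a) k)

  segment-last : ∀ a k → last (segment f a (suc k)) ≡ just (f (a +ℕ k))
  segment-last a zero = cong (just ∘ f) (sym (NP.+-identityʳ a))
  segment-last a (suc k) = trans (segment-last (suc a) k) (cong (just ∘ f) (sym (NP.+-suc a k)))

  segment-all : ∀ (P : A → Set) a k → (∀ b → a ≤ b → b < a +ℕ k → P (f b)) → All P (segment f a k)
  segment-all P a zero h = []
  segment-all P a (suc k) h = h a NP.≤-refl (NP.m<m+n a (s≤s z≤n)) ∷
    segment-all P (suc a) k (λ b a<b b<k → h b (NP.<⇒≤ a<b) (subst (b <_) (sym (NP.+-suc a k)) b<k))

  segment-distinct : ∀ a k → (∀ b c → a ≤ b → b < c → c < a +ℕ k → f b ≢ f c) →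
    AllPairs _≢_ (segment f a k)
  segment-distinct a zero h = []
  segment-distinct a (suc k) h =
    segment-all (f a ≢_) (suc a) k (λ c a<c c<k → h a c NP.≤-refl a<c (subst (c <_) (sym (NP.+-suc a k)) c<k)) ∷
    segment-distinct (suc a) k (λ b c a<b b<c c<k → h b c (NP.<⇒≤ a<b) b<c (subst (c <_) (sym (NP.+-suc a k)) c<k))

module _ {n : ℕ} (G : Graph n) where

  open DecMembership (F._≟_ {n}) using (_∈?_)

  adj-sym : ∀ {u v} → Adj G u v → Adj G v u
  adj-sym {u} {v} a = trans (Graph.sym G v u) a

  adj-irr : ∀ {u v} → Adj G u v → u ≢ v
  adj-irr {u} a refl = false≢true (trans (sym (irrefl G u)) a)

  Adj? : ∀ u v → Dec (Adj G u v)
  Adj? u v = adj G u v BP.≟ true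

  Isolated : VSet n → Fin n → Set
  Isolated W w = ∀ u → W u ≡ true → ¬ Adj G w u

  isolated? : ∀ W w → Dec (Isolated W w)
  isolated? W w = all? λ u → (W u BP.≟ true) →-dec ¬? (Adj? w u)

  Edges : Set
  Edges = List (Fin n × Fin n)

  -- All endpoints of M lie in W (a record, so that W stays inferable).
  record Within (W : VSet n) (M : Edges) : Set where
    constructor within
    field inside : ∀ x → Saturates M x → W x ≡ true
  open Within

  MatchingIn : VSet n → Edges → Set
  MatchingIn W M = IsMatching G M × Within W M

  MaximumIn : VSet n → Edges → Set
  MaximumIn W M = MatchingIn W M × (∀ N → MatchingIn W N → length N ≤ length M)

  EGIn : VSet n → Fin n → Set
  EGIn W v = ∃ λ M → MaximumIn W M × ¬ Saturates M v

  partner : ∀ {M x} → IsMatching G M → Saturates M x → ∃ λ y → Adj G x y × Saturates M y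
  partner {(u , v) ∷ M} (a ∷ _ , _) (here refl) = v , a , there (here refl)
  partner {(u , v) ∷ M} (a ∷ _ , _) (there (here refl)) = u , adj-sym a , here refl
  partner {(u , v) ∷ M} (_ ∷ as , (_ ∷ _ ∷ U)) (there (there m)) with partner (as , U) m
  ... | y , a , my = y , a , there (there my)

  matching-uncons : ∀ {u v M} → IsMatching G ((u , v) ∷ M) →
    Adj G u v × ¬ Saturates M u × ¬ Saturates M v × IsMatching G M
  matching-uncons (a ∷ as , ((_ ∷ u∉) ∷ v∉ ∷ U)) = a , All¬⇒¬Any u∉ , All¬⇒¬Any v∉ , as , U

  matching-cons : ∀ {u v M} → Adj G u v → ¬ Saturates M u → ¬ Saturates M v → IsMatching G M →
    IsMatching G ((u , v) ∷ M)
  matching-cons {M = M} a u∉ v∉ (as , U) =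
    a ∷ as , ((adj-irr a ∷ ¬Any⇒All¬ (endpoints M) u∉) ∷ ¬Any⇒All¬ (endpoints M) v∉ ∷ U)

  record Unmatched (p : Fin n) (M : Edges) : Set where
    field
      mate : Fin n
      rest : Edges
      p~mate : Adj G p mate
      length-rest : length M ≡ suc (length rest)
      rest-matching : IsMatching G rest
      rest⊆M : ∀ x → Saturates rest x → Saturates M x
      p-free : ¬ Saturates rest p
      mate-free : ¬ Saturates rest mate
      mate-saturated : Saturates M mate

  unmatch : ∀ p M → IsMatching G M → Saturates M p → Unmatched p M
  unmatch p ((u , v) ∷ M) mt (here refl) with matching-uncons mt
  ... | a , u∉ , v∉ , mt′ = record
    { mate = v ; rest = M ; p~mate = a ; length-rest = refl ; rest-matching = mt′
    ; rest⊆M = λ x m → there (there m) ; p-free = u∉ ; mate-free = v∉ ; mate-saturated = there (here refl) }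
  unmatch p ((u , v) ∷ M) mt (there (here refl)) with matching-uncons mt
  ... | a , u∉ , v∉ , mt′ = record
    { mate = u ; rest = M ; p~mate = adj-sym a ; length-rest = refl ; rest-matching = mt′
    ; rest⊆M = λ x m → there (there m) ; p-free = v∉ ; mate-free = u∉ ; mate-saturated = here refl }
  unmatch p ((u , v) ∷ M) mt (there (there p∈M)) with matching-uncons mt
  ... | a , u∉ , v∉ , mt′ = record
    { mate = R.mate ; rest = (u , v) ∷ R.rest ; p~mate = R.p~mate
    ; length-rest = cong suc R.length-rest
    ; rest-matching = matching-cons a (u∉ ∘ R.rest⊆M u) (v∉ ∘ R.rest⊆M v) R.rest-matching
    ; rest⊆M = rest⊆ ; p-free = p-free ; mate-free = mate-free ; mate-saturated = there (there R.mate-saturated) }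
    where
    module R = Unmatched (unmatch p M mt′ p∈M)
    rest⊆ : ∀ x → Saturates ((u , v) ∷ R.rest) x → Saturates ((u , v) ∷ M) x
    rest⊆ x (here e) = here e
    rest⊆ x (there (here e)) = there (here e)
    rest⊆ x (there (there m)) = there (there (R.rest⊆M x m))
    p-free : ¬ Saturates ((u , v) ∷ R.rest) p
    p-free (here refl) = u∉ p∈M
    p-free (there (here refl)) = v∉ p∈M
    p-free (there (there m)) = R.p-free m
    mate-free : ¬ Saturates ((u , v) ∷ R.rest) R.mate
    mate-free (here e) = u∉ (subst (Saturates M) e R.mate-saturated)
    mate-free (there (here e)) = v∉ (subst (Saturates M) e R.mate-saturated)
    mate-free (there (there m)) = R.mate-free m

  module IsolatedMatching (W : VSet n) (w : Fin n) (w-isolated : Isolated W w) where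
    W⁻ : VSet n
    W⁻ = remove w W

    within-remove : ∀ {M} → MatchingIn W M → Within W⁻ M
    within-remove {M} (mt , wi) = within inside⁻
      where
      inside⁻ : ∀ x → Saturates M x → W⁻ x ≡ true
      inside⁻ x m with x F.≟ w
      ... | no _ = inside wi x m
      ... | yes refl with partner mt m
      ...   | y , a , my = ⊥-elim (w-isolated y (inside wi y my) a)

    within-grow : ∀ {M} → Within W⁻ M → Within W M
    within-grow wi = within λ x m → proj₁ (remove-true W (inside wi x m))

    maximum-remove : ∀ {M} → MaximumIn W M → MaximumIn W⁻ M
    maximum-remove ((mt , wi) , largest) =
      (mt , within-remove (mt , wi)) , λ N (mN , wN) → largest N (mN , within-grow wN)

    maximum-grow : ∀ {M} → MaximumIn W⁻ M → MaximumIn W M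
    maximum-grow ((mt , wi) , largest) = (mt , within-grow wi) , λ N mN → largest N (proj₁ mN , within-remove mN)

    EG-remove : ∀ {v} → EGIn W v → EGIn W⁻ v
    EG-remove (M , max , v∉) = M , maximum-remove max , v∉

    EG-grow : ∀ {v} → EGIn W⁻ v → EGIn W v
    EG-grow (M , max , v∉) = M , maximum-grow max , v∉

    -- w is missed by every matching inside W⁻, in particular by a maximum one.
    EG-isolated : ∀ {M} → MaximumIn W⁻ M → EGIn W w
    EG-isolated {M} max = M , maximum-grow max ,
      λ m → false≢true (trans (sym (remove-self w W)) (inside (proj₂ (proj₁ max)) w m))

  record Pendant (W : VSet n) : Set where
    field
      ℓ p : Fin n
      ℓ∈W : W ℓ ≡ true
      p∈W : W p ≡ true
      ℓ~p : Adj G ℓ p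
      ℓ-leaf : ∀ u → W u ≡ true → Adj G ℓ u → u ≡ p

  module PendantSet {W : VSet n} (P : Pendant W) where
    open Pendant P public

    W⁻ : VSet n
    W⁻ = remove p (remove ℓ W)

    ℓ≢p : ℓ ≢ p
    ℓ≢p = adj-irr ℓ~p

    W⁻⇒ : ∀ {u} → W⁻ u ≡ true → W u ≡ true × u ≢ ℓ × u ≢ p
    W⁻⇒ e with remove-true (remove ℓ W) e
    ... | e′ , u≢p with remove-true W e′
    ...   | u∈W , u≢ℓ = u∈W , u≢ℓ , u≢p

    ⇒W⁻ : ∀ {u} → W u ≡ true → u ≢ ℓ → u ≢ p → W⁻ u ≡ true
    ⇒W⁻ u∈W u≢ℓ u≢p = trans (remove-other (remove ℓ W) u≢p) (trans (remove-other W u≢ℓ) u∈W)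

    W⁻-false : ∀ {j} → W⁻ j ≡ false → W j ≡ false ⊎ j ≡ ℓ ⊎ j ≡ p
    W⁻-false e with remove-false (remove ℓ W) e
    ... | inj₂ j≡p = inj₂ (inj₂ j≡p)
    ... | inj₁ e′ with remove-false W e′
    ...   | inj₁ j∉W = inj₁ j∉W
    ...   | inj₂ j≡ℓ = inj₂ (inj₁ j≡ℓ)

    ℓ∉W⁻ : W⁻ ℓ ≡ false
    ℓ∉W⁻ = trans (remove-other (remove ℓ W) ℓ≢p) (remove-self ℓ W)

    p∉W⁻ : W⁻ p ≡ false
    p∉W⁻ = remove-self p (remove ℓ W)

    W⁻-smaller : count W⁻ < count W
    W⁻-smaller = NP.<-trans (count-remove-< p (remove ℓ W) (trans (remove-other W (ℓ≢p ∘ sym)) p∈W))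
                            (count-remove-< ℓ W ℓ∈W)

    StemNeighbour : (Fin n → Set) → Set
    StemNeighbour X = ∃ λ q → W⁻ q ≡ true × Adj G p q × X q

  -- Maximum matchings of G[W] are those of G[W⁻] plus one edge at p; hence p
  -- is never in EG, other vertices keep their status, and ℓ is in EG exactly
  -- when some neighbour of p is in EG of G[W⁻].
  module PendantMatching {W : VSet n} (P : Pendant W) where
    open PendantSet P

    ℓ-forces-p : ∀ {M} → MatchingIn W M → Saturates M ℓ → Saturates M p
    ℓ-forces-p {M} (mt , wi) m with partner mt m
    ... | y , a , my = subst (Saturates M) (ℓ-leaf y (inside wi y my) a) my

    within⁻ : ∀ {M} → MatchingIn W M → ¬ Saturates M p → Within W⁻ M
    within⁻ {M} mW p∉ = within λ x m →
      ⇒W⁻ (inside (proj₂ mW) x m)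
          (λ x≡ℓ → p∉ (ℓ-forces-p mW (subst (Saturates M) x≡ℓ m)))
          (λ x≡p → p∉ (subst (Saturates M) x≡p m))

    within⁻⇒within : ∀ {M} → Within W⁻ M → Within W M
    within⁻⇒within wi = within λ x m → proj₁ (W⁻⇒ (inside wi x m))

    ℓ-free : ∀ {M} → Within W⁻ M → ¬ Saturates M ℓ
    ℓ-free wi m = false≢true (trans (sym ℓ∉W⁻) (inside wi ℓ m))

    p-free : ∀ {M} → Within W⁻ M → ¬ Saturates M p
    p-free wi m = false≢true (trans (sym p∉W⁻) (inside wi p m))

    add-ℓp : ∀ {M} → MatchingIn W⁻ M → MatchingIn W ((ℓ , p) ∷ M)
    add-ℓp {M} (mt , wi) = matching-cons ℓ~p (ℓ-free wi) (p-free wi) mt , within inside⁺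
      where
      inside⁺ : ∀ x → Saturates ((ℓ , p) ∷ M) x → W x ≡ true
      inside⁺ x (here refl) = ℓ∈W
      inside⁺ x (there (here refl)) = p∈W
      inside⁺ x (there (there m)) = inside (within⁻⇒within wi) x m

    shrink : ∀ N → MatchingIn W N → ∃ λ N₀ → MatchingIn W⁻ N₀ × length N ≤ suc (length N₀)
    shrink N (mt , wi) with p ∈? endpoints N
    ... | no p∉ = N , (mt , within⁻ (mt , wi) p∉) , NP.n≤1+n _
    ... | yes p∈ = R.rest , (R.rest-matching , within⁻ mW R.p-free) , NP.≤-reflexive R.length-rest
      where
      module R = Unmatched (unmatch p N mt p∈)
      mW : MatchingIn W R.rest
      mW = R.rest-matching , within λ x m → inside wi x (R.rest⊆M x m)

    maximum-cons : ∀ {u v M} → MaximumIn W⁻ M → MatchingIn W ((u , v) ∷ M) → MaximumIn W ((u , v) ∷ M)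
    maximum-cons (_ , largest) mW = mW , λ N mN →
      let (N₀ , mN₀ , N≤) = shrink N mN in NP.≤-trans N≤ (s≤s (largest N₀ mN₀))

    -- A maximum matching of G[W] covers p: otherwise ℓ–p could be added.
    p-saturated : ∀ {M} → MaximumIn W M → Saturates M p
    p-saturated {M} (mW , largest) with p ∈? endpoints M
    ... | yes p∈ = p∈
    ... | no p∉ = ⊥-elim (NP.<-irrefl refl (largest _ (add-ℓp (proj₁ mW , within⁻ mW p∉))))

    maximum-shrink : ∀ {M} → MaximumIn W M → Σ (Unmatched p M) λ R → MaximumIn W⁻ (Unmatched.rest R)
    maximum-shrink {M} (mW , largest) = R , (R.rest-matching , within⁻ mR R.p-free) , λ K mK →
        NP.≤-pred (subst (suc (length K) ≤_) R.length-rest (largest _ (add-ℓp mK)))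
      where
      R : Unmatched p M
      R = unmatch p M (proj₁ mW) (p-saturated (mW , largest))
      module R = Unmatched R
      mR : MatchingIn W R.rest
      mR = R.rest-matching , within λ x m → inside (proj₂ mW) x (R.rest⊆M x m)

    EG-p : ¬ EGIn W p
    EG-p (M , max , p∉) = p∉ (p-saturated max)

    EG-other⇒ : ∀ {v} → EGIn W v → EGIn W⁻ v
    EG-other⇒ {v} (M , max , v∉) with maximum-shrink max
    ... | R , max⁻ = Unmatched.rest R , max⁻ , v∉ ∘ Unmatched.rest⊆M R v

    EG-other⇐ : ∀ {v} → v ≢ ℓ → v ≢ p → EGIn W⁻ v → EGIn W v
    EG-other⇐ {v} v≢ℓ v≢p (M , max , v∉) = (ℓ , p) ∷ M , maximum-cons max (add-ℓp (proj₁ max)) , v∉⁺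
      where
      v∉⁺ : ¬ Saturates ((ℓ , p) ∷ M) v
      v∉⁺ (here e) = v≢ℓ e
      v∉⁺ (there (here e)) = v≢p e
      v∉⁺ (there (there m)) = v∉ m

    EG-ℓ⇒ : EGIn W ℓ → StemNeighbour (EGIn W⁻)
    EG-ℓ⇒ (M , max , ℓ∉) with maximum-shrink max
    ... | R , max⁻ =
      R.mate , ⇒W⁻ (inside (proj₂ (proj₁ max)) R.mate R.mate-saturated)
                   (λ e → ℓ∉ (subst (Saturates M) e R.mate-saturated))
                   (λ e → adj-irr R.p~mate (sym e)) ,
      R.p~mate , R.rest , max⁻ , R.mate-free
      where module R = Unmatched R

    EG-ℓ⇐ : StemNeighbour (EGIn W⁻) → EGIn W ℓ
    EG-ℓ⇐ (q , q∈W⁻ , p~q , M , max@((mt , wi) , _) , q∉) =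
      (p , q) ∷ M , maximum-cons max (matching-cons p~q (p-free wi) q∉ mt , within inside⁺) , ℓ∉
      where
      inside⁺ : ∀ x → Saturates ((p , q) ∷ M) x → W x ≡ true
      inside⁺ x (here refl) = p∈W
      inside⁺ x (there (here refl)) = proj₁ (W⁻⇒ q∈W⁻)
      inside⁺ x (there (there m)) = inside (within⁻⇒within wi) x m
      ℓ∉ : ¬ Saturates ((p , q) ∷ M) ℓ
      ℓ∉ (here e) = ℓ≢p e
      ℓ∉ (there (here e)) = proj₁ (proj₂ (W⁻⇒ q∈W⁻)) (sym e)
      ℓ∉ (there (there m)) = ℓ-free wi m

  row : Fin n → (Fin n → ℚ) → ℚ
  row i x = Σℚ n (λ j → adjMatrix G i j * x j)

  -- Null vectors of A(G[W]) extended by zero, and Supp of G[W].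
  NullIn : VSet n → (Fin n → ℚ) → Set
  NullIn W x = (∀ u → W u ≡ false → x u ≡ 0ℚ) × (∀ i → W i ≡ true → row i x ≡ 0ℚ)

  SuppIn : VSet n → Fin n → Set
  SuppIn W v = ∃ λ x → NullIn W x × x v ≢ 0ℚ

  entry-absent : ∀ {i j} → adj G i j ≡ false → ∀ z → adjMatrix G i j * z ≡ 0ℚ
  entry-absent {i} {j} e z rewrite e = QP.*-zeroˡ z

  entry-present : ∀ {i j} → adj G i j ≡ true → ∀ z → adjMatrix G i j * z ≡ z
  entry-present {i} {j} e z rewrite e = QP.*-identityˡ z

  entry-times-zero : ∀ i j {z} → z ≡ 0ℚ → adjMatrix G i j * z ≡ 0ℚ
  entry-times-zero i j refl = QP.*-zeroʳ (adjMatrix G i j)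

  nonzero⇒in : ∀ {W x u} → NullIn W x → x u ≢ 0ℚ → W u ≡ true
  nonzero⇒in {W} {x} {u} null xu≢0 with true-or-false (W u)
  ... | inj₁ u∈W = u∈W
  ... | inj₂ u∉W = ⊥-elim (xu≢0 (proj₁ null u u∉W))

  restrict : VSet n → (Fin n → ℚ) → Fin n → ℚ
  restrict U x j = if U j then x j else 0ℚ

  restrict-in : ∀ U x {j} → U j ≡ true → restrict U x j ≡ x j
  restrict-in U x {j} e rewrite e = refl

  restrict-out : ∀ U x {j} → U j ≡ false → restrict U x j ≡ 0ℚ
  restrict-out U x {j} e rewrite e = refl

  δ : Fin n → Fin n → ℚ
  δ k j = if does (j F.≟ k) then 1ℚ else 0ℚ

  δ-self : ∀ k → δ k k ≡ 1ℚ
  δ-self k with k F.≟ k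
  ... | yes _ = refl
  ... | no k≢k = ⊥-elim (k≢k refl)

  δ-other : ∀ {k j} → j ≢ k → δ k j ≡ 0ℚ
  δ-other {k} {j} j≢k with j F.≟ k
  ... | yes j≡k = ⊥-elim (j≢k j≡k)
  ... | no _ = refl

  δ-scaled-other : ∀ {k j} c → j ≢ k → δ k j * c ≡ 0ℚ
  δ-scaled-other c j≢k = trans (cong (_* c) (δ-other j≢k)) (QP.*-zeroˡ c)

  δ-scaled-self : ∀ k c → δ k k * c ≡ c
  δ-scaled-self k c = trans (cong (_* c) (δ-self k)) (QP.*-identityˡ c)

  row-single : ∀ i k x → Adj G i k → (∀ j → j ≢ k → adjMatrix G i j * x j ≡ 0ℚ) → row i x ≡ x k
  row-single i k x i~k others = trans (Σ-single n _ k others) (entry-present i~k (x k))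

  module IsolatedNull (W : VSet n) (w : Fin n) (w∈W : W w ≡ true) (w-isolated : Isolated W w) where
    W⁻ : VSet n
    W⁻ = remove w W

    column-w : ∀ i → W i ≡ true → adj G i w ≡ false
    column-w i i∈W = BP.¬-not (λ e → w-isolated i i∈W (adj-sym e))

    -- Rows indexed by W do not see the value at w.
    restrict-term : ∀ {x} → NullIn W x → ∀ i → W i ≡ true → ∀ j →
      adjMatrix G i j * restrict W⁻ x j ≡ adjMatrix G i j * x j
    restrict-term {x} null i i∈W j with true-or-false (W⁻ j)
    ... | inj₁ j∈W⁻ = cong (adjMatrix G i j *_) (restrict-in W⁻ x j∈W⁻)
    ... | inj₂ j∉W⁻ with remove-false W j∉W⁻
    ...   | inj₁ j∉W = trans (entry-times-zero i j (restrict-out W⁻ x j∉W⁻))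
                             (sym (entry-times-zero i j (proj₁ null j j∉W)))
    ...   | inj₂ refl = trans (entry-absent (column-w i i∈W) _) (sym (entry-absent (column-w i i∈W) _))

    Supp-remove : ∀ {v} → v ≢ w → SuppIn W v → SuppIn W⁻ v
    Supp-remove {v} v≢w (x , null , xv≢0) =
      restrict W⁻ x , ((λ u → restrict-out W⁻ x) , rows) ,
      λ e → xv≢0 (trans (sym (restrict-in W⁻ x (trans (remove-other W v≢w) (nonzero⇒in null xv≢0)))) e)
      where
      rows : ∀ i → W⁻ i ≡ true → row i (restrict W⁻ x) ≡ 0ℚ
      rows i i∈W⁻ = let i∈W = proj₁ (remove-true W i∈W⁻) in
        trans (Σ-cong n _ _ (restrict-term null i i∈W)) (proj₂ null i i∈W)

    Supp-grow : ∀ {v} → SuppIn W⁻ v → SuppIn W v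
    Supp-grow (x , null , xv≢0) = x , (outside , rows) , xv≢0
      where
      outside : ∀ u → W u ≡ false → x u ≡ 0ℚ
      outside u u∉W with u F.≟ w
      ... | yes refl = ⊥-elim (false≢true (trans (sym u∉W) w∈W))
      ... | no u≢w = proj₁ null u (trans (remove-other W u≢w) u∉W)
      row-w-term : ∀ j → adjMatrix G w j * x j ≡ 0ℚ
      row-w-term j with true-or-false (adj G w j)
      ... | inj₂ w≁j = entry-absent w≁j _
      ... | inj₁ w~j with true-or-false (W⁻ j)
      ...   | inj₁ j∈W⁻ = ⊥-elim (w-isolated j (proj₁ (remove-true W j∈W⁻)) w~j)
      ...   | inj₂ j∉W⁻ = entry-times-zero w j (proj₁ null j j∉W⁻)
      rows : ∀ i → W i ≡ true → row i x ≡ 0ℚ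
      rows i i∈W with i F.≟ w
      ... | yes refl = Σ-zero n _ row-w-term
      ... | no i≢w = proj₂ null i (trans (remove-other W i≢w) i∈W)

    Supp-isolated : SuppIn W w
    Supp-isolated = δ w , (outside , rows) , λ e → QP.1≢0 (trans (sym (δ-self w)) e)
      where
      outside : ∀ u → W u ≡ false → δ w u ≡ 0ℚ
      outside u u∉W = δ-other {w} {u} λ { refl → false≢true (trans (sym u∉W) w∈W) }
      term : ∀ i → W i ≡ true → ∀ j → adjMatrix G i j * δ w j ≡ 0ℚ
      term i i∈W j with same-or-different j w
      ... | inj₁ refl = entry-absent (column-w i i∈W) _
      ... | inj₂ j≢w = entry-times-zero i j (δ-other j≢w)
      rows : ∀ i → W i ≡ true → row i (δ w) ≡ 0ℚ
      rows i i∈W = Σ-zero n _ (term i i∈W)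

  Σ-δ : ∀ k c → Σℚ n (λ j → δ k j * c) ≡ c
  Σ-δ k c = trans (Σ-single n _ k (λ j j≢k → δ-scaled-other c j≢k)) (δ-scaled-self k c)

  -- The two shapes of a pendant edge ℓ–p for which the null space can be
  -- controlled: p has a second leaf, or p has at most one neighbour besides ℓ.
  SecondLeaf : ∀ {W} → Pendant W → Set
  SecondLeaf {W} P =
    ∃ λ ℓ′ → W ℓ′ ≡ true × ℓ′ ≢ ℓ × Adj G p ℓ′ × (∀ u → W u ≡ true → Adj G ℓ′ u → u ≡ p)
    where open Pendant P

  FewNeighbours : ∀ {W} → Pendant W → Set
  FewNeighbours {W} P =
    ∀ a b → W a ≡ true → W b ≡ true → a ≢ ℓ → b ≢ ℓ → Adj G p a → Adj G p b → a ≡ b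
    where open Pendant P

  -- Null vectors of G[W] restrict to null vectors of G[W⁻], and a null vector y
  -- of G[W⁻] extends to one of G[W] by the value - row p y at ℓ.  Hence p is
  -- never in Supp, other vertices keep their status, and ℓ is in Supp iff some
  -- null vector y of G[W⁻] has row p y ≠ 0.
  module PendantNull {W : VSet n} (P : Pendant W) where
    open PendantSet P
    open ≡-Reasoning

    ℓ-row : ∀ j → W j ≡ true → j ≢ p → adj G ℓ j ≡ false
    ℓ-row j j∈W j≢p = BP.¬-not (λ e → j≢p (ℓ-leaf j j∈W e))

    ℓ-column : ∀ i → W i ≡ true → i ≢ p → adj G i ℓ ≡ false
    ℓ-column i i∈W i≢p = trans (Graph.sym G i ℓ) (ℓ-row i i∈W i≢p)

    -- Row ℓ of a null vector reads off its value at p.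
    null-at-p : ∀ {x} → NullIn W x → x p ≡ 0ℚ
    null-at-p {x} null = trans (sym (row-single ℓ p x ℓ~p others)) (proj₂ null ℓ ℓ∈W)
      where
      others : ∀ j → j ≢ p → adjMatrix G ℓ j * x j ≡ 0ℚ
      others j j≢p with true-or-false (W j)
      ... | inj₁ j∈W = entry-absent (ℓ-row j j∈W j≢p) _
      ... | inj₂ j∉W = entry-times-zero ℓ j (proj₁ null j j∉W)

    restrict-term : ∀ {x} → NullIn W x → ∀ i j → (j ≢ ℓ ⊎ adj G i ℓ ≡ false) →
      adjMatrix G i j * restrict W⁻ x j ≡ adjMatrix G i j * x j
    restrict-term {x} null i j unseen with true-or-false (W⁻ j)
    ... | inj₁ j∈W⁻ = cong (adjMatrix G i j *_) (restrict-in W⁻ x j∈W⁻)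
    ... | inj₂ j∉W⁻ with W⁻-false j∉W⁻ | unseen
    ...   | inj₁ j∉W | _ = trans (entry-times-zero i j (restrict-out W⁻ x j∉W⁻))
                                 (sym (entry-times-zero i j (proj₁ null j j∉W)))
    ...   | inj₂ (inj₂ j≡p) | _ = trans (entry-times-zero i j (restrict-out W⁻ x j∉W⁻))
                                       (sym (entry-times-zero i j (trans (cong x j≡p) (null-at-p null))))
    ...   | inj₂ (inj₁ j≡ℓ) | inj₁ j≢ℓ = ⊥-elim (j≢ℓ j≡ℓ)
    ...   | inj₂ (inj₁ refl) | inj₂ i≁ℓ = trans (entry-absent i≁ℓ _) (sym (entry-absent i≁ℓ _))

    restrict-null : ∀ {x} → NullIn W x → NullIn W⁻ (restrict W⁻ x)
    restrict-null {x} null = (λ u → restrict-out W⁻ x) , rows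
      where
      rows : ∀ i → W⁻ i ≡ true → row i (restrict W⁻ x) ≡ 0ℚ
      rows i i∈W⁻ with W⁻⇒ i∈W⁻
      ... | i∈W , _ , i≢p =
        trans (Σ-cong n _ _ (λ j → restrict-term null i j (inj₂ (ℓ-column i i∈W i≢p)))) (proj₂ null i i∈W)

    row-p-term : ∀ {x} → NullIn W x → ∀ j →
      adjMatrix G p j * x j ≡ adjMatrix G p j * restrict W⁻ x j + δ ℓ j * x ℓ
    row-p-term {x} null j with same-or-different j ℓ
    ... | inj₁ refl = begin
      adjMatrix G p ℓ * x ℓ                            ≡⟨ entry-present (adj-sym ℓ~p) (x ℓ) ⟩
      x ℓ                                              ≡⟨ QP.+-identityˡ (x ℓ) ⟨
      0ℚ + x ℓ                                         ≡⟨ cong₂ _+_ (entry-times-zero p ℓ (restrict-out W⁻ x ℓ∉W⁻))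
                                                                   (δ-scaled-self ℓ (x ℓ)) ⟨
      adjMatrix G p ℓ * restrict W⁻ x ℓ + δ ℓ ℓ * x ℓ  ∎
    ... | inj₂ j≢ℓ = begin
      adjMatrix G p j * x j                            ≡⟨ restrict-term null p j (inj₁ j≢ℓ) ⟨
      adjMatrix G p j * restrict W⁻ x j                ≡⟨ QP.+-identityʳ _ ⟨
      adjMatrix G p j * restrict W⁻ x j + 0ℚ           ≡⟨ cong (adjMatrix G p j * restrict W⁻ x j +_)
                                                               (δ-scaled-other (x ℓ) j≢ℓ) ⟨
      adjMatrix G p j * restrict W⁻ x j + δ ℓ j * x ℓ  ∎

    row-p-split : ∀ {x} → NullIn W x → row p x ≡ row p (restrict W⁻ x) + x ℓ
    row-p-split {x} null = begin
      row p x                                                  ≡⟨ Σ-cong n _ _ (row-p-term null) ⟩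
      Σℚ n (λ j → adjMatrix G p j * restrict W⁻ x j + δ ℓ j * x ℓ) ≡⟨ Σ-+ n _ _ ⟩
      row p (restrict W⁻ x) + Σℚ n (λ j → δ ℓ j * x ℓ)         ≡⟨ cong (row p (restrict W⁻ x) +_) (Σ-δ ℓ (x ℓ)) ⟩
      row p (restrict W⁻ x) + x ℓ                              ∎

    module Extension (y : Fin n → ℚ) (null-y : NullIn W⁻ y) where
      c : ℚ
      c = - row p y

      x : Fin n → ℚ
      x j = y j + δ ℓ j * c

      row-x : ∀ i → row i x ≡ row i y + adjMatrix G i ℓ * c
      row-x i = begin
        row i x
          ≡⟨ Σ-cong n _ _ (λ j → QP.*-distribˡ-+ (adjMatrix G i j) (y j) (δ ℓ j * c)) ⟩
        Σℚ n (λ j → adjMatrix G i j * y j + adjMatrix G i j * (δ ℓ j * c)) ≡⟨ Σ-+ n _ _ ⟩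
        row i y + Σℚ n (λ j → adjMatrix G i j * (δ ℓ j * c))      ≡⟨ cong (row i y +_) (Σ-single n _ ℓ others) ⟩
        row i y + adjMatrix G i ℓ * (δ ℓ ℓ * c)                   ≡⟨ cong (λ z → row i y + adjMatrix G i ℓ * z)
                                                                          (δ-scaled-self ℓ c) ⟩
        row i y + adjMatrix G i ℓ * c                             ∎
        where
        others : ∀ j → j ≢ ℓ → adjMatrix G i j * (δ ℓ j * c) ≡ 0ℚ
        others j j≢ℓ = entry-times-zero i j (δ-scaled-other c j≢ℓ)

      -- ℓ has no neighbour in W⁻.
      row-ℓ-y : row ℓ y ≡ 0ℚ
      row-ℓ-y = Σ-zero n _ term
        where
        term : ∀ j → adjMatrix G ℓ j * y j ≡ 0ℚ
        term j with true-or-false (W⁻ j)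
        ... | inj₁ j∈W⁻ = let (j∈W , _ , j≢p) = W⁻⇒ j∈W⁻ in entry-absent (ℓ-row j j∈W j≢p) _
        ... | inj₂ j∉W⁻ = entry-times-zero ℓ j (proj₁ null-y j j∉W⁻)

      -- Row p is corrected by c; all other rows of W are unaffected.
      x-null : NullIn W x
      x-null = outside , rows
        where
        outside : ∀ u → W u ≡ false → x u ≡ 0ℚ
        outside u u∉W = trans
          (cong₂ _+_ (proj₁ null-y u (BP.¬-not (λ e → false≢true (trans (sym u∉W) (proj₁ (W⁻⇒ e))))))
                     (δ-scaled-other {ℓ} {u} c λ { refl → false≢true (trans (sym u∉W) ℓ∈W) }))
          (QP.+-identityˡ 0ℚ)
        rows : ∀ i → W i ≡ true → row i x ≡ 0ℚ
        rows i i∈W with same-or-different i ℓ | same-or-different i p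
        ... | inj₁ refl | _ = begin
          row ℓ x                        ≡⟨ row-x ℓ ⟩
          row ℓ y + adjMatrix G ℓ ℓ * c  ≡⟨ cong₂ _+_ row-ℓ-y (entry-absent (irrefl G ℓ) c) ⟩
          0ℚ + 0ℚ                        ≡⟨ QP.+-identityˡ 0ℚ ⟩
          0ℚ                             ∎
        ... | inj₂ _ | inj₁ refl = begin
          row p x                        ≡⟨ row-x p ⟩
          row p y + adjMatrix G p ℓ * c  ≡⟨ cong (row p y +_) (entry-present (adj-sym ℓ~p) c) ⟩
          row p y + - row p y            ≡⟨ QP.+-inverseʳ (row p y) ⟩
          0ℚ                             ∎
        ... | inj₂ i≢ℓ | inj₂ i≢p = begin
          row i x                        ≡⟨ row-x i ⟩
          row i y + adjMatrix G i ℓ * c  ≡⟨ cong₂ _+_ (proj₂ null-y i (⇒W⁻ i∈W i≢ℓ i≢p))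
                                                      (entry-absent (ℓ-column i i∈W i≢p) c) ⟩
          0ℚ + 0ℚ                        ≡⟨ QP.+-identityˡ 0ℚ ⟩
          0ℚ                             ∎

      x-at-ℓ : x ℓ ≡ c
      x-at-ℓ = trans (cong₂ _+_ (proj₁ null-y ℓ ℓ∉W⁻) (δ-scaled-self ℓ c)) (QP.+-identityˡ c)

      x-elsewhere : ∀ {v} → v ≢ ℓ → x v ≡ y v
      x-elsewhere {v} v≢ℓ = trans (cong (y v +_) (δ-scaled-other c v≢ℓ)) (QP.+-identityʳ (y v))

    Supp-ℓ-from-row : ∀ y → NullIn W⁻ y → row p y ≢ 0ℚ → SuppIn W ℓ
    Supp-ℓ-from-row y null-y row≢0 =
      E.x , E.x-null , λ e → row≢0 (QP.neg-injective (trans (sym E.x-at-ℓ) e))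
      where module E = Extension y null-y

    Supp-p : ¬ SuppIn W p
    Supp-p (x , null , xp≢0) = xp≢0 (null-at-p null)

    Supp-other⇒ : ∀ {v} → W⁻ v ≡ true → SuppIn W v → SuppIn W⁻ v
    Supp-other⇒ {v} v∈W⁻ (x , null , xv≢0) =
      restrict W⁻ x , restrict-null null , λ e → xv≢0 (trans (sym (restrict-in W⁻ x v∈W⁻)) e)

    Supp-other⇐ : ∀ {v} → v ≢ ℓ → SuppIn W⁻ v → SuppIn W v
    Supp-other⇐ {v} v≢ℓ (y , null-y , yv≢0) =
      E.x , E.x-null , λ e → yv≢0 (trans (sym (E.x-elsewhere v≢ℓ)) e)
      where module E = Extension y null-y

    Supp-ℓ⇒ : SuppIn W ℓ → StemNeighbour (SuppIn W⁻)
    Supp-ℓ⇒ (x , null , xℓ≢0) = neighbour (Σ-nonzero-term n _ row-p≢0)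
      where
      x⁻ : Fin n → ℚ
      x⁻ = restrict W⁻ x
      row-p≢0 : row p x⁻ ≢ 0ℚ
      row-p≢0 e = xℓ≢0 (begin
        x ℓ            ≡⟨ QP.+-identityˡ (x ℓ) ⟨
        0ℚ + x ℓ       ≡⟨ cong (_+ x ℓ) e ⟨
        row p x⁻ + x ℓ ≡⟨ row-p-split null ⟨
        row p x        ≡⟨ proj₂ null p p∈W ⟩
        0ℚ             ∎)
      neighbour : (∃ λ j → adjMatrix G p j * x⁻ j ≢ 0ℚ) → StemNeighbour (SuppIn W⁻)
      neighbour (j , term≢0) with true-or-false (adj G p j)
      ... | inj₂ p≁j = ⊥-elim (term≢0 (entry-absent p≁j _))
      ... | inj₁ p~j = j , nonzero⇒in (restrict-null null) x⁻j≢0 , p~j , x⁻ , restrict-null null , x⁻j≢0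
        where
        x⁻j≢0 : x⁻ j ≢ 0ℚ
        x⁻j≢0 e = term≢0 (entry-times-zero p j e)

    -- A second leaf ℓ′ is isolated in G[W⁻]; its unit vector has row p equal to 1.
    Supp-ℓ-secondLeaf : SecondLeaf P → SuppIn W ℓ
    Supp-ℓ-secondLeaf (ℓ′ , ℓ′∈W , ℓ′≢ℓ , p~ℓ′ , ℓ′-leaf) =
      Supp-ℓ-from-row (δ ℓ′) (outside , rows) row-p≢0
      where
      ℓ′∈W⁻ : W⁻ ℓ′ ≡ true
      ℓ′∈W⁻ = ⇒W⁻ ℓ′∈W ℓ′≢ℓ (λ e → adj-irr p~ℓ′ (sym e))
      outside : ∀ u → W⁻ u ≡ false → δ ℓ′ u ≡ 0ℚ
      outside u u∉W⁻ = δ-other {ℓ′} {u} λ { refl → false≢true (trans (sym u∉W⁻) ℓ′∈W⁻) }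
      term : ∀ i → W⁻ i ≡ true → ∀ j → adjMatrix G i j * δ ℓ′ j ≡ 0ℚ
      term i i∈W⁻ j with same-or-different j ℓ′
      ... | inj₂ j≢ℓ′ = entry-times-zero i j (δ-other j≢ℓ′)
      ... | inj₁ refl with true-or-false (adj G i ℓ′)
      ...   | inj₂ i≁ℓ′ = entry-absent i≁ℓ′ _
      ...   | inj₁ i~ℓ′ = let (i∈W , _ , i≢p) = W⁻⇒ i∈W⁻ in ⊥-elim (i≢p (ℓ′-leaf i i∈W (adj-sym i~ℓ′)))
      rows : ∀ i → W⁻ i ≡ true → row i (δ ℓ′) ≡ 0ℚ
      rows i i∈W⁻ = Σ-zero n _ (term i i∈W⁻)
      row-p≢0 : row p (δ ℓ′) ≢ 0ℚ
      row-p≢0 e = QP.1≢0 (trans (sym (δ-self ℓ′))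
        (trans (sym (row-single p ℓ′ (δ ℓ′) p~ℓ′ (λ j j≢ℓ′ → entry-times-zero p j (δ-other j≢ℓ′)))) e))

    -- If q is the only neighbour of p in W⁻, row p y is just y q.
    Supp-ℓ-fewNeighbours : FewNeighbours P → StemNeighbour (SuppIn W⁻) → SuppIn W ℓ
    Supp-ℓ-fewNeighbours few (q , q∈W⁻ , p~q , y , null-y , yq≢0) =
      Supp-ℓ-from-row y null-y (λ e → yq≢0 (trans (sym (row-single p q y p~q others)) e))
      where
      others : ∀ j → j ≢ q → adjMatrix G p j * y j ≡ 0ℚ
      others j j≢q with true-or-false (adj G p j)
      ... | inj₂ p≁j = entry-absent p≁j _
      ... | inj₁ p~j with true-or-false (W⁻ j)
      ...   | inj₂ j∉W⁻ = entry-times-zero p j (proj₁ null-y j j∉W⁻)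
      ...   | inj₁ j∈W⁻ = let (j∈W , j≢ℓ , _) = W⁻⇒ j∈W⁻ ; (q∈W , q≢ℓ , _) = W⁻⇒ q∈W⁻ in
                          ⊥-elim (j≢q (few j q j∈W q∈W j≢ℓ q≢ℓ p~j p~q))

  segment-chain : ∀ f → (∀ k → Adj G (f k) (f (suc k))) → ∀ a k → Chain G (segment f a k)
  segment-chain f adjacent a zero = tt
  segment-chain f adjacent a (suc zero) = tt
  segment-chain f adjacent a (suc (suc k)) = adjacent a , segment-chain f adjacent (suc a) (suc k)

  record NonBacktracking (f : ℕ → Fin n) : Set where
    field
      adjacent : ∀ k → Adj G (f k) (f (suc k))
      no-return : ∀ k → f (suc (suc k)) ≢ f k

  -- An infinite non-backtracking walk closes a cycle: between the first
  -- repeated vertex and its earlier occurrence it runs along distinct vertices.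
  nonBacktracking-cycle : Acyclic G → ∀ f → NonBacktracking f → ⊥
  nonBacktracking-cycle acyclic f walk = closes (j ∸ i) (NP.m+[n∸m]≡n (NP.<⇒≤ i<j))
    where
    open FirstRepeat (firstRepeat f)
    open NonBacktracking walk
    -- j = i + k: k = 0 contradicts i < j, k = 1 a loop, k = 2 backtracking,
    -- and k ≥ 3 gives the cycle f i, …, f (j - 1).
    closes : ∀ k → i +ℕ k ≡ j → ⊥
    closes zero e = NP.<-irrefl (trans (sym (NP.+-identityʳ i)) e) i<j
    closes (suc zero) e = adj-irr (adjacent i) (trans repeat (cong f (trans (sym e) (NP.+-comm i 1))))
    closes (suc (suc zero)) e = no-return i (trans (cong f (trans (NP.+-comm 2 i) e)) (sym repeat))
    closes (suc (suc (suc k))) e = acyclic (segment f i (3 +ℕ k))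
      ( subst (3 ≤_) (sym (segment-length f i (3 +ℕ k))) (s≤s (s≤s (s≤s z≤n)))
      , segment-distinct f i (3 +ℕ k) (λ b c _ b<c c<k → injective-below b c b<c (subst (c <_) e c<k))
      , segment-chain f adjacent i (3 +ℕ k)
      , f i , f (i +ℕ (2 +ℕ k)) , refl , segment-last f i (2 +ℕ k)
      , subst (Adj G (f (i +ℕ (2 +ℕ k)))) (trans (cong f (trans (sym (NP.+-suc i (2 +ℕ k))) e)) (sym repeat))
              (adjacent (i +ℕ (2 +ℕ k))) )

  TwoNeighbours : VSet n → Fin n → Set
  TwoNeighbours U v = ∃ λ a → ∃ λ b → U a ≡ true × U b ≡ true × a ≢ b × Adj G v a × Adj G v b

  twoNeighbours? : ∀ U v → Dec (TwoNeighbours U v)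
  twoNeighbours? U v = any? λ a → any? λ b →
    (U a BP.≟ true) ×-dec (U b BP.≟ true) ×-dec ¬? (a F.≟ b) ×-dec Adj? v a ×-dec Adj? v b

  AtMostOneNeighbour : VSet n → Fin n → Set
  AtMostOneNeighbour U v = ∀ a b → U a ≡ true → U b ≡ true → Adj G v a → Adj G v b → a ≡ b

  atMostOne : ∀ {U v} → ¬ TwoNeighbours U v → AtMostOneNeighbour U v
  atMostOne ¬two a b a∈U b∈U v~a v~b with a F.≟ b
  ... | yes a≡b = a≡b
  ... | no a≢b = ⊥-elim (¬two (a , b , a∈U , b∈U , a≢b , v~a , v~b))

  module TurningWalk (U : VSet n) (two : ∀ u → U u ≡ true → TwoNeighbours U u) where
    record Arc : Set where
      constructor arc
      field
        source target : Fin n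
        target∈U : U target ≡ true
        source~target : Adj G source target
    open Arc

    turn : ∀ a b → U b ≡ true → Σ (Fin n) λ c → U c ≡ true × Adj G b c × c ≢ a
    turn a b b∈U with two b b∈U
    ... | c , d , c∈U , d∈U , c≢d , b~c , b~d with c F.≟ a
    ...   | yes c≡a = d , d∈U , b~d , λ d≡a → c≢d (trans c≡a (sym d≡a))
    ...   | no c≢a = c , c∈U , b~c , c≢a

    advance : Arc → Arc
    advance s = arc (target s) (proj₁ t) (proj₁ (proj₂ t)) (proj₁ (proj₂ (proj₂ t)))
      where
      t : Σ (Fin n) λ c → U c ≡ true × Adj G (target s) c × c ≢ source s
      t = turn (source s) (target s) (target∈U s)

    walk : Arc → ℕ → Arc
    walk s zero = s
    walk s (suc k) = advance (walk s k)

    nonBacktracking : ∀ s → NonBacktracking (λ k → source (walk s k))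
    nonBacktracking s = record
      { adjacent = λ k → source~target (walk s k)
      ; no-return = λ k → let w = walk s k in proj₂ (proj₂ (proj₂ (turn (source w) (target w) (target∈U w)))) }

  lowDegreeVertex : Acyclic G → ∀ U u₀ → U u₀ ≡ true → ∃ λ u → U u ≡ true × AtMostOneNeighbour U u
  lowDegreeVertex acyclic U u₀ u₀∈U with any? (λ u → (U u BP.≟ true) ×-dec ¬? (twoNeighbours? U u))
  ... | yes (u , u∈U , ¬two) = u , u∈U , atMostOne ¬two
  ... | no none = ⊥-elim (nonBacktracking-cycle acyclic _ (T.nonBacktracking start))
    where
    two : ∀ u → U u ≡ true → TwoNeighbours U u
    two u u∈U = decidable-stable (twoNeighbours? U u) (λ ¬two → none (u , u∈U , ¬two))
    module T = TurningWalk U two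
    start : T.Arc
    start with two u₀ u₀∈U
    ... | a , _ , a∈U , _ , _ , u₀~a , _ = T.arc u₀ a a∈U u₀~a

  Reducible : VSet n → Set
  Reducible W = Σ (Pendant W) λ P → SecondLeaf P ⊎ FewNeighbours P

  -- In a forest without isolated vertices in W, a reducible pendant edge exists:
  -- take p among the branching vertices (two neighbours in W) with at most one
  -- branching neighbour; its non-branching neighbours are leaves.
  module FindReducible (acyclic : Acyclic G) (W : VSet n) (no-isolated : ∀ w → W w ≡ true → ¬ Isolated W w) where

    hasNeighbour : ∀ v → W v ≡ true → ∃ λ u → W u ≡ true × Adj G v u
    hasNeighbour v v∈W with any? (λ u → (W u BP.≟ true) ×-dec Adj? v u)
    ... | yes found = found
    ... | no none = ⊥-elim (no-isolated v v∈W λ u u∈W v~u → none (u , u∈W , v~u))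

    Branching : VSet n
    Branching u = if does (twoNeighbours? W u) then W u else false

    branching⇒ : ∀ {u} → Branching u ≡ true → W u ≡ true × TwoNeighbours W u
    branching⇒ {u} e with twoNeighbours? W u
    ... | yes two = e , two
    ... | no _ = ⊥-elim (false≢true e)

    ⇒branching : ∀ {u} → W u ≡ true → TwoNeighbours W u → Branching u ≡ true
    ⇒branching {u} u∈W two with twoNeighbours? W u
    ... | yes _ = u∈W
    ... | no ¬two = ⊥-elim (¬two two)

    not-branching : ∀ {u} → W u ≡ true → Branching u ≡ false → ¬ TwoNeighbours W u
    not-branching {u} u∈W e with twoNeighbours? W u
    ... | yes _ = ⊥-elim (false≢true (trans (sym e) u∈W))
    ... | no ¬two = ¬two

    leaf-at : ∀ {c p} → W c ≡ true → W p ≡ true → Adj G p c → Branching c ≡ false →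
      ∀ u → W u ≡ true → Adj G c u → u ≡ p
    leaf-at c∈W p∈W p~c c-thin u u∈W c~u = atMostOne (not-branching c∈W c-thin) u _ u∈W p∈W c~u (adj-sym p~c)

    -- Without branching vertices, v₀ and its neighbour form a component with two vertices.
    reducible-edge : ∀ v₀ → W v₀ ≡ true → (∀ u → Branching u ≢ true) → Reducible W
    reducible-edge v₀ v₀∈W none with hasNeighbour v₀ v₀∈W
    ... | p , p∈W , v₀~p = record
      { ℓ = v₀ ; p = p ; ℓ∈W = v₀∈W ; p∈W = p∈W ; ℓ~p = v₀~p
      ; ℓ-leaf = λ u u∈W v₀~u → atMostOne (thin v₀∈W) u p u∈W p∈W v₀~u v₀~p }
      , inj₂ (λ a b a∈W b∈W _ _ p~a p~b → atMostOne (thin p∈W) a b a∈W b∈W p~a p~b)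
      where
      thin : ∀ {u} → W u ≡ true → ¬ TwoNeighbours W u
      thin u∈W two = none _ (⇒branching u∈W two)

    thinNeighbour : ∀ p → Branching p ≡ true → AtMostOneNeighbour Branching p →
      ∃ λ c → W c ≡ true × Adj G p c × Branching c ≡ false
    thinNeighbour p p-branching few with branching⇒ p-branching
    ... | _ , a , b , a∈W , b∈W , a≢b , p~a , p~b with true-or-false (Branching a) | true-or-false (Branching b)
    ...   | inj₂ a-thin | _ = a , a∈W , p~a , a-thin
    ...   | inj₁ _ | inj₂ b-thin = b , b∈W , p~b , b-thin
    ...   | inj₁ a-br | inj₁ b-br = ⊥-elim (a≢b (few a b a-br b-br p~a p~b))

    -- The leaf c at p is reducible: either p has a second non-branching
    -- neighbour (a second leaf), or all its other neighbours branch, and there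
    -- is at most one such.
    reducible-branch : ∀ p → Branching p ≡ true → AtMostOneNeighbour Branching p → Reducible W
    reducible-branch p p-branching few with thinNeighbour p p-branching few
    ... | c , c∈W , p~c , c-thin = P , shape
      where
      p∈W : W p ≡ true
      p∈W = proj₁ (branching⇒ p-branching)
      P : Pendant W
      P = record { ℓ = c ; p = p ; ℓ∈W = c∈W ; p∈W = p∈W ; ℓ~p = adj-sym p~c
                 ; ℓ-leaf = leaf-at c∈W p∈W p~c c-thin }
      shape : SecondLeaf P ⊎ FewNeighbours P
      shape with any? (λ l → (W l BP.≟ true) ×-dec ¬? (l F.≟ c) ×-dec Adj? p l ×-dec (Branching l BP.≟ false))
      ... | yes (l , l∈W , l≢c , p~l , l-thin) = inj₁ (l , l∈W , l≢c , p~l , leaf-at l∈W p∈W p~l l-thin)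
      ... | no none = inj₂ λ a b a∈W b∈W a≢c b≢c p~a p~b →
        few a b (branches a a∈W a≢c p~a) (branches b b∈W b≢c p~b) p~a p~b
        where
        branches : ∀ x → W x ≡ true → x ≢ c → Adj G p x → Branching x ≡ true
        branches x x∈W x≢c p~x with true-or-false (Branching x)
        ... | inj₁ x-br = x-br
        ... | inj₂ x-thin = ⊥-elim (none (x , x∈W , x≢c , p~x , x-thin))

    reducible : ∀ v₀ → W v₀ ≡ true → Reducible W
    reducible v₀ v₀∈W with any? (λ u → Branching u BP.≟ true)
    ... | no none = reducible-edge v₀ v₀∈W (λ u e → none (u , e))
    ... | yes (u₀ , u₀-branching) with lowDegreeVertex acyclic Branching u₀ u₀-branching
    ...   | p , p-branching , few = reducible-branch p p-branching few

  Agree : VSet n → Set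
  Agree W = (∃ λ M → MaximumIn W M) × (∀ v → W v ≡ true → EGIn W v ⇔ SuppIn W v)

  agree-empty : ∀ {W} → (∀ v → W v ≢ true) → Agree W
  agree-empty {W} empty = ([] , (([] , []) , within λ _ ()) , largest) , λ v v∈W → ⊥-elim (empty v v∈W)
    where
    largest : ∀ N → MatchingIn W N → length N ≤ 0
    largest [] _ = z≤n
    largest ((u , _) ∷ N) mN = ⊥-elim (empty u (inside (proj₂ mN) u (here refl)))

  agree-isolated : ∀ W w → W w ≡ true → Isolated W w → Agree (remove w W) → Agree W
  agree-isolated W w w∈W isolated ((M , max) , agree⁻) = (M , IM.maximum-grow max) , agree
    where
    module IM = IsolatedMatching W w isolated
    module IN = IsolatedNull W w w∈W isolated
    agree : ∀ v → W v ≡ true → EGIn W v ⇔ SuppIn W v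
    agree v v∈W with same-or-different v w
    ... | inj₁ refl = mk⇔ (λ _ → IN.Supp-isolated) (λ _ → IM.EG-isolated max)
    ... | inj₂ v≢w = mk⇔ (IN.Supp-grow ∘ Equivalence.to ih ∘ IM.EG-remove)
                         (IM.EG-grow ∘ Equivalence.from ih ∘ IN.Supp-remove v≢w)
      where
      ih : EGIn (remove w W) v ⇔ SuppIn (remove w W) v
      ih = agree⁻ v (trans (remove-other W v≢w) v∈W)

  -- At the leaf both memberships reduce to that of a neighbour of p in G[W⁻].
  agree-leaf : ∀ W (P : Pendant W) → SecondLeaf P ⊎ FewNeighbours P →
    (∀ v → PendantSet.W⁻ P v ≡ true → EGIn (PendantSet.W⁻ P) v ⇔ SuppIn (PendantSet.W⁻ P) v) →
    EGIn W (Pendant.ℓ P) ⇔ SuppIn W (Pendant.ℓ P)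
  agree-leaf W P shape agree⁻ =
    mk⇔ to (PM.EG-ℓ⇐ ∘ neighbour (λ {q} q∈W⁻ → Equivalence.from (agree⁻ q q∈W⁻)) ∘ PN.Supp-ℓ⇒)
    where
    open PendantSet P
    module PM = PendantMatching P
    module PN = PendantNull P
    neighbour : ∀ {X Y : Fin n → Set} → (∀ {q} → W⁻ q ≡ true → X q → Y q) → StemNeighbour X → StemNeighbour Y
    neighbour X⇒Y (q , q∈W⁻ , p~q , Xq) = q , q∈W⁻ , p~q , X⇒Y q∈W⁻ Xq
    to : EGIn W ℓ → SuppIn W ℓ
    to = [ (λ second _ → PN.Supp-ℓ-secondLeaf second)
         , (λ few → PN.Supp-ℓ-fewNeighbours few
                  ∘ neighbour (λ {q} q∈W⁻ → Equivalence.to (agree⁻ q q∈W⁻)) ∘ PM.EG-ℓ⇒)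
         ]′ shape

  agree-pendant : ∀ W → (R : Reducible W) → Agree (PendantSet.W⁻ (proj₁ R)) → Agree W
  agree-pendant W (P , shape) ((M , max) , agree⁻) = (_ , PM.maximum-cons max (PM.add-ℓp (proj₁ max))) , agree
    where
    open PendantSet P
    module PM = PendantMatching P
    module PN = PendantNull P
    agree : ∀ v → W v ≡ true → EGIn W v ⇔ SuppIn W v
    agree v v∈W with same-or-different v ℓ | same-or-different v p
    ... | inj₁ refl | _ = agree-leaf W P shape agree⁻
    ... | inj₂ _ | inj₁ refl = mk⇔ (⊥-elim ∘ PM.EG-p) (⊥-elim ∘ PN.Supp-p)
    ... | inj₂ v≢ℓ | inj₂ v≢p = mk⇔ (PN.Supp-other⇐ v≢ℓ ∘ Equivalence.to ih ∘ PM.EG-other⇒)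
                                    (PM.EG-other⇐ v≢ℓ v≢p ∘ Equivalence.from ih ∘ PN.Supp-other⇒ v∈W⁻)
      where
      v∈W⁻ : W⁻ v ≡ true
      v∈W⁻ = ⇒W⁻ v∈W v≢ℓ v≢p
      ih : EGIn W⁻ v ⇔ SuppIn W⁻ v
      ih = agree⁻ v v∈W⁻

  agree-all : Acyclic G → ∀ W → Agree W
  agree-all acyclic = All.wfRec (On.wellFounded count <-wellFounded) 0ℓ Agree reduce
    where
    reduce : ∀ W → (∀ {W′} → count W′ < count W → Agree W′) → Agree W
    reduce W smaller with any? (λ v → W v BP.≟ true)
    ... | no empty = agree-empty λ v v∈W → empty (v , v∈W)
    ... | yes (v₀ , v₀∈W) with any? (λ w → (W w BP.≟ true) ×-dec isolated? W w)
    ...   | yes (w , w∈W , isolated) = agree-isolated W w w∈W isolated (smaller (count-remove-< w W w∈W))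
    ...   | no none = agree-pendant W R (smaller (PendantSet.W⁻-smaller (proj₁ R)))
      where
      R : Reducible W
      R = FindReducible.reducible acyclic W (λ w w∈W isolated → none (w , w∈W , isolated)) v₀ v₀∈W

  everything : VSet n
  everything _ = true

  EG⇔EGIn : ∀ v → EG G v ⇔ EGIn everything v
  EG⇔EGIn v = mk⇔
    (λ { (M , (mt , largest) , v∉) → M , ((mt , within λ _ _ → refl) , λ N mN → largest N (proj₁ mN)) , v∉ })
    (λ { (M , ((mt , _) , largest) , v∉) → M , (mt , λ N mN → largest N (mN , within λ _ _ → refl)) , v∉ })

  Supp⇔SuppIn : ∀ v → Supp G v ⇔ SuppIn everything v
  Supp⇔SuppIn v = mk⇔
    (λ { (x , null , xv≢0) → x , ((λ _ ()) , λ i _ → null i) , xv≢0 })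
    (λ { (x , (_ , rows) , xv≢0) → x , (λ i → rows i refl) , xv≢0 })

  forest-EG⇔Supp : Acyclic G → ∀ v → EG G v ⇔ Supp G v
  forest-EG⇔Supp acyclic v = mk⇔
    (Equivalence.from (Supp⇔SuppIn v) ∘ Equivalence.to agree ∘ Equivalence.to (EG⇔EGIn v))
    (Equivalence.from (EG⇔EGIn v) ∘ Equivalence.from agree ∘ Equivalence.to (Supp⇔SuppIn v))
    where
    agree : EGIn everything v ⇔ SuppIn everything v
    agree = proj₂ (agree-all acyclic everything) v refl

mainTheorem10 : ∀ {n} (S : Graph n) → IsSTree S →
    ∀ (v : Fin n) → (EG S v → Supp S v) × (Supp S v → EG S v)
mainTheorem10 S ((_ , _ , acyclic) , _) v = Equivalence.to EG⇔Supp , Equivalence.from EG⇔Supp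
  where
  EG⇔Supp : EG S v ⇔ Supp S v
  EG⇔Supp = forest-EG⇔Supp S acyclic v
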